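{- For every simply typed $\lambda$-term $M$: (1) if $M\to^* N$ in the Call-by-Name $\lambda$-calculus, then $*;M^{\mathrm n}\to^*\widehat N^{\mathrm n}$ in the ptq-calculus; (2) if $M\to^*N$ in the Call-by-Value $\lambda$-calculus, then $M^{\mathrm v}\,*\to^*\widehat N^{\mathrm v}$ in the ptq-calculus.
   Context: Call-by-Name and Call-by-Value $\lambda$-calculi (lazy, no reduction under $\lambda$; a value $V$ is a variable or an abstraction). CbN one-step: $(\lambda x.M)N\to M[N/x]$, and $M\to M_1$ implies $MN\to M_1N$. CbV one-step (argument evaluated first): $(\lambda x.M)V\to M[V/x]$ for $V$ a value; $N\to N_1$ implies $MN\to MN_1$; $M\to M_1$ implies $MV\to M_1V$ for $V$ a value. $\to^*$ denotes reflexive–transitive closure. ptq-calculus: p-variables (identified with $\lambda$-variables), a t-variable $k$, a constant $*$; p-terms $p::=x\mid\lambda\langle x,k\rangle.u\mid\lambda k.u$; t-terms $t::=*\mid k\mid\langle p,t\rangle\mid\lambda x.u$; q-terms $q::=\overline{\lambda}k.u$; e-terms $u::=t;p\mid q\,t$; binders $\lambda\langle x,k\rangle$ (binds $x,k$), $\lambda k,\overline\lambda k$ (bind $k$), $\lambda x$ (binds $x$); terms modulo $\alpha$-conversion. For $u$ with $k$ free, $u_*:=u[*/k]$; t-closed means no free t-variable. Reduction (on t-closed e-terms, only at top level): $*;\lambda k.u\to u[*/k]$; $\langle p,t_*\rangle;\lambda k.u\to u[\langle p,t_*\rangle/k]$; $\langle p,t_*\rangle;\lambda\langle x,k\rangle.u\to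 u[p/x,t_*/k]$; $(\lambda x.u_*);p\to u_*[p/x]$; $(\overline\lambda k.u)\,t_*\to u[t_*/k]$; $\to^*$ is its reflexive–transitive closure. Composition: $t_*\cdot a_*:=a_*[t_*/*]$. Translations: $x^{\mathrm n}=x$, $(\lambda x.M)^{\mathrm n}=\lambda\langle x,k\rangle.k;M^{\mathrm n}$, $(MN)^{\mathrm n}=\lambda k.\langle N^{\mathrm n},k\rangle;M^{\mathrm n}$; $x^{\mathrm v}=\overline\lambda k.k;x$, $(\lambda x.M)^{\mathrm v}=\overline\lambda k.k;(\lambda\langle x,k\rangle.M^{\mathrm v}k)$, $(MN)^{\mathrm v}=\overline\lambda k.N^{\mathrm v}(\lambda x.M^{\mathrm v}\langle x,k\rangle)$. On values: $\overline x^{\mathrm n}=\overline x^{\mathrm v}=x$, $\overline{\lambda x.M}^{\mathrm n}=\lambda\langle x,k\rangle.k;M^{\mathrm n}$, $\overline{\lambda x.M}^{\mathrm v}=\lambda\langle x,k\rangle.M^{\mathrm v}k$. E-term translations: $\widehat V^{\mathrm n}=*;\overline V^{\mathrm n}$, $\widehat{MN}^{\mathrm n}=\langle N^{\mathrm n},*\rangle\cdot\widehat M^{\mathrm n}$; $\widehat V^{\mathrm v}=*;\overline V^{\mathrm v}$, $\widehat{MV}^{\mathrm v}=\langle\overline V^{\mathrm v},*\rangle\cdot\widehat M^{\mathrm v}$ ($V$ value), $\widehat{MN}^{\mathrm v}=(\lambda x.M^{\mathrm v}\langle x,*\rangle)\cdot\widehat N^{\mathrm v}$ ($N$ not a value,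 $x$ fresh). -}

module Defs where

open import Data.Nat using (ℕ; zero; suc)
open import Data.Bool using (Bool; true; false; _∧_)
open import Data.List using (List; []; _∷_)
open import Relation.Binary.PropositionalEquality using (_≡_)

-- Simply typed λ-calculus (de Bruijn indices, variable 0 = innermost)

infixr 7 _⇒_
data Ty : Set where
  ι   : ℕ → Ty
  _⇒_ : Ty → Ty → Ty

data Λ : Set where
  var : ℕ → Λ
  lam : Λ → Λ
  app : Λ → Λ → Λ

Ctx : Set
Ctx = List Ty

data _∋_∶_ : Ctx → ℕ → Ty → Set where
  here  : ∀ {Γ A} → (A ∷ Γ) ∋ zero ∶ A
  there : ∀ {Γ A B i} → Γ ∋ i ∶ A → (B ∷ Γ) ∋ suc i ∶ A

data _⊢_∶_ : Ctx → Λ → Ty → Set where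
  ⊢var : ∀ {Γ i A} → Γ ∋ i ∶ A → Γ ⊢ var i ∶ A
  ⊢lam : ∀ {Γ M A B} → (A ∷ Γ) ⊢ M ∶ B → Γ ⊢ lam M ∶ (A ⇒ B)
  ⊢app : ∀ {Γ M N A B} → Γ ⊢ M ∶ (A ⇒ B) → Γ ⊢ N ∶ A → Γ ⊢ app M N ∶ B

extR : (ℕ → ℕ) → ℕ → ℕ
extR ρ zero    = zero
extR ρ (suc i) = suc (ρ i)

renΛ : (ℕ → ℕ) → Λ → Λ
renΛ ρ (var i)   = var (ρ i)
renΛ ρ (lam M)   = lam (renΛ (extR ρ) M)
renΛ ρ (app M N) = app (renΛ ρ M) (renΛ ρ N)

extsΛ : (ℕ → Λ) → ℕ → Λ
extsΛ σ zero    = var zero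
extsΛ σ (suc i) = renΛ suc (σ i)

subΛ : (ℕ → Λ) → Λ → Λ
subΛ σ (var i)   = σ i
subΛ σ (lam M)   = lam (subΛ (extsΛ σ) M)
subΛ σ (app M N) = app (subΛ σ M) (subΛ σ N)

single : Λ → ℕ → Λ
single N zero    = N
single N (suc i) = var i

_[_] : Λ → Λ → Λ
M [ N ] = subΛ (single N) M

data Value : Λ → Set where
  v-var : ∀ {i} → Value (var i)
  v-lam : ∀ {M} → Value (lam M)

infix 4 _→n_
data _→n_ : Λ → Λ → Set where
  βn   : ∀ {M N} → app (lam M) N →n M [ N ]
  appL : ∀ {M M₁ N} → M →n M₁ → app M N →n app M₁ N

-- Call-by-Value one-step reduction (argument first)
infix 4 _→v_
data _→v_ : Λ → Λ → Set where
  βv    : ∀ {M V} → Value V → app (lam M) V →v M [ V ]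
  appRv : ∀ {M N N₁} → N →v N₁ → app M N →v app M N₁
  appLv : ∀ {M M₁ V} → Value V → M →v M₁ → app M V →v app M₁ V

-- ptq-calculus.
-- p-variables: de Bruijn indices (bound by λ⟨x,k⟩ and λx).
-- There is a single t-variable k; every occurrence of k refers to the
-- innermost enclosing k-binder (λ⟨x,k⟩, λk, λ̄k), so it is a constant `kv`.

mutual
  data PTerm : Set where
    pv    : ℕ → PTerm
    lamXK : ETerm → PTerm
    lamK  : ETerm → PTerm

  data TTerm : Set where
    star : TTerm
    kv   : TTerm
    ⟨_,_⟩ : PTerm → TTerm → TTerm
    lamX : ETerm → TTerm

  data QTerm : Set where
    lamBarK : ETerm → QTerm

  data ETerm : Set where
    _⨾_  : TTerm → PTerm → ETerm
    appQ : QTerm → TTerm → ETerm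

infix 5 _⨾_

mutual
  renP : (ℕ → ℕ) → PTerm → PTerm
  renP ρ (pv i)    = pv (ρ i)
  renP ρ (lamXK u) = lamXK (renE (extR ρ) u)
  renP ρ (lamK u)  = lamK (renE ρ u)

  renT : (ℕ → ℕ) → TTerm → TTerm
  renT ρ star      = star
  renT ρ kv        = kv
  renT ρ ⟨ p , t ⟩ = ⟨ renP ρ p , renT ρ t ⟩
  renT ρ (lamX u)  = lamX (renE (extR ρ) u)

  renQ : (ℕ → ℕ) → QTerm → QTerm
  renQ ρ (lamBarK u) = lamBarK (renE ρ u)

  renE : (ℕ → ℕ) → ETerm → ETerm
  renE ρ (t ⨾ p)    = renT ρ t ⨾ renP ρ p
  renE ρ (appQ q t) = appQ (renQ ρ q) (renT ρ t)

extsP : (ℕ → PTerm) → ℕ → PTerm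
extsP σ zero    = pv zero
extsP σ (suc i) = renP suc (σ i)

mutual
  subP : (ℕ → PTerm) → PTerm → PTerm
  subP σ (pv i)    = σ i
  subP σ (lamXK u) = lamXK (subE (extsP σ) u)
  subP σ (lamK u)  = lamK (subE σ u)

  subT : (ℕ → PTerm) → TTerm → TTerm
  subT σ star      = star
  subT σ kv        = kv
  subT σ ⟨ p , t ⟩ = ⟨ subP σ p , subT σ t ⟩
  subT σ (lamX u)  = lamX (subE (extsP σ) u)

  subQ : (ℕ → PTerm) → QTerm → QTerm
  subQ σ (lamBarK u) = lamBarK (subE σ u)

  subE : (ℕ → PTerm) → ETerm → ETerm
  subE σ (t ⨾ p)    = subT σ t ⨾ subP σ p
  subE σ (appQ q t) = appQ (subQ σ q) (subT σ t)

singleP' : PTerm → ℕ → PTerm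
singleP' p zero    = p
singleP' p (suc i) = pv i

_[_/x] : ETerm → PTerm → ETerm
u [ p /x] = subE (singleP' p) u

-- u [ t / k ] : substitute t for the free occurrences of k
-- (t is t-closed in all uses, so no k-capture can occur)
mutual
  kSubP : PTerm → TTerm → PTerm
  kSubP (pv i)    t = pv i
  kSubP (lamXK u) t = lamXK u
  kSubP (lamK u)  t = lamK u

  kSubT : TTerm → TTerm → TTerm
  kSubT star      t = star
  kSubT kv        t = t
  kSubT ⟨ p , s ⟩ t = ⟨ kSubP p t , kSubT s t ⟩
  kSubT (lamX u)  t = lamX (kSubE u (renT suc t))

  kSubQ : QTerm → TTerm → QTerm
  kSubQ (lamBarK u) t = lamBarK u

  kSubE : ETerm → TTerm → ETerm
  kSubE (s ⨾ p)    t = kSubT s t ⨾ kSubP p t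
  kSubE (appQ q s) t = appQ (kSubQ q t) (kSubT s t)

_[_/k] : ETerm → TTerm → ETerm
u [ t /k] = kSubE u t

_[_/x,_/k] : ETerm → PTerm → TTerm → ETerm
u [ p /x, t /k] = (u [ p /x]) [ t /k]

mutual
  stP : PTerm → TTerm → PTerm
  stP (pv i)    t = pv i
  stP (lamXK u) t = lamXK (stE u (renT suc t))
  stP (lamK u)  t = lamK (stE u t)

  stT : TTerm → TTerm → TTerm
  stT star      t = t
  stT kv        t = kv
  stT ⟨ p , s ⟩ t = ⟨ stP p t , stT s t ⟩
  stT (lamX u)  t = lamX (stE u (renT suc t))

  stQ : QTerm → TTerm → QTerm
  stQ (lamBarK u) t = lamBarK (stE u t)

  stE : ETerm → TTerm → ETerm
  stE (s ⨾ p)    t = stT s t ⨾ stP p t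
  stE (appQ q s) t = appQ (stQ q t) (stT s t)

_∙_ : TTerm → ETerm → ETerm
t ∙ a = stE a t

mutual
  closedP : PTerm → Bool
  closedP (pv i)    = true
  closedP (lamXK u) = true
  closedP (lamK u)  = true

  closedT : TTerm → Bool
  closedT star      = true
  closedT kv        = false
  closedT ⟨ p , t ⟩ = closedP p ∧ closedT t
  closedT (lamX u)  = closedE u

  closedQ : QTerm → Bool
  closedQ (lamBarK u) = true

  closedE : ETerm → Bool
  closedE (t ⨾ p)    = closedT t ∧ closedP p
  closedE (appQ q t) = closedQ q ∧ closedT t

TClosed : ETerm → Set
TClosed u = closedE u ≡ true

infix 4 _⟶_
data _⟶_ : ETerm → ETerm → Set where
  r-*k   : ∀ {u} → TClosed (star ⨾ lamK u) →
           (star ⨾ lamK u) ⟶ u [ star /k]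
  r-⟨⟩k  : ∀ {p t u} → TClosed (⟨ p , t ⟩ ⨾ lamK u) →
           (⟨ p , t ⟩ ⨾ lamK u) ⟶ u [ ⟨ p , t ⟩ /k]
  r-⟨⟩xk : ∀ {p t u} → TClosed (⟨ p , t ⟩ ⨾ lamXK u) →
           (⟨ p , t ⟩ ⨾ lamXK u) ⟶ u [ p /x, t /k]
  r-x    : ∀ {u p} → TClosed (lamX u ⨾ p) →
           (lamX u ⨾ p) ⟶ u [ p /x]
  r-q    : ∀ {u t} → TClosed (appQ (lamBarK u) t) →
           appQ (lamBarK u) t ⟶ u [ t /k]

transN : Λ → PTerm
transN (var i)   = pv i
transN (lam M)   = lamXK (kv ⨾ transN M)
transN (app M N) = lamK (⟨ transN N , kv ⟩ ⨾ transN M)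

-- CbV  (in (MN)^v the bound x is fresh, hence M^v is weakened)
transV : Λ → QTerm
transV (var i)   = lamBarK (kv ⨾ pv i)
transV (lam M)   = lamBarK (kv ⨾ lamXK (appQ (transV M) kv))
transV (app M N) =
  lamBarK (appQ (transV N) (lamX (appQ (renQ suc (transV M)) ⟨ pv zero , kv ⟩)))

valN : (V : Λ) → Value V → PTerm
valN (var i) v-var = pv i
valN (lam M) v-lam = lamXK (kv ⨾ transN M)

valV : (V : Λ) → Value V → PTerm
valV (var i) v-var = pv i
valV (lam M) v-lam = lamXK (appQ (transV M) kv)

hatN : Λ → ETerm
hatN (var i)   = star ⨾ valN (var i) v-var
hatN (lam M)   = star ⨾ valN (lam M) v-lam
hatN (app M N) = ⟨ transN N , star ⟩ ∙ hatN M

hatV : Λ → ETerm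
hatV (var i)           = star ⨾ valV (var i) v-var
hatV (lam M)           = star ⨾ valV (lam M) v-lam
hatV (app M (var i))   = ⟨ valV (var i) v-var , star ⟩ ∙ hatV M
hatV (app M (lam N))   = ⟨ valV (lam N) v-lam , star ⟩ ∙ hatV M
hatV (app M (app N L)) =
  lamX (appQ (renQ suc (transV M)) ⟨ pv zero , star ⟩) ∙ hatV (app N L)

-- Both translations simulate an abstract machine. A term M run against a
-- continuation t is represented by the e-term obtained by pushing the
-- arguments of M onto t: by name, M N pushes ⟨N^n, t⟩; by value, M V pushes
-- ⟨V̄^v, t⟩, while M N with N not a value runs N against the frame
-- λx.M^v⟨x,t⟩. Administrative steps bring t;M^n (resp. M^v t) to this state,
-- and a β-step of the source calculus becomes one ptq step on the state followed
-- by administrative steps, because the translations commute with substitution.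
-- Finally N̂ is the state of N against the empty continuation *: composing
-- with t only replaces *, and * does not occur in M^n or M^v.
module Submission where

open import Defs
open import Data.Bool using (true; _∧_)
open import Data.Bool.Properties using (∧-identityʳ)
open import Data.Nat using (ℕ; zero; suc)
open import Data.Product using (_×_; _,_)
open import Function using (_∘_)
open import Relation.Binary.Construct.Closure.ReflexiveTransitive
  using (Star; ε; _◅_; _◅◅_; kleisliStar)
open import Relation.Binary.PropositionalEquality
  using (_≡_; refl; sym; trans; cong; cong₂; _≗_)

-- Renaming and substitution of p-variables

extR-cong : ∀ {ρ ρ′ : ℕ → ℕ} → ρ ≗ ρ′ → extR ρ ≗ extR ρ′
extR-cong h zero    = refl
extR-cong h (suc i) = cong suc (h i)

mutual
  renP-cong : ∀ {ρ ρ′} → ρ ≗ ρ′ → ∀ p → renP ρ p ≡ renP ρ′ p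
  renP-cong h (pv i)    = cong pv (h i)
  renP-cong h (lamXK u) = cong lamXK (renE-cong (extR-cong h) u)
  renP-cong h (lamK u)  = cong lamK (renE-cong h u)

  renT-cong : ∀ {ρ ρ′} → ρ ≗ ρ′ → ∀ t → renT ρ t ≡ renT ρ′ t
  renT-cong h star      = refl
  renT-cong h kv        = refl
  renT-cong h ⟨ p , t ⟩ = cong₂ ⟨_,_⟩ (renP-cong h p) (renT-cong h t)
  renT-cong h (lamX u)  = cong lamX (renE-cong (extR-cong h) u)

  renQ-cong : ∀ {ρ ρ′} → ρ ≗ ρ′ → ∀ q → renQ ρ q ≡ renQ ρ′ q
  renQ-cong h (lamBarK u) = cong lamBarK (renE-cong h u)

  renE-cong : ∀ {ρ ρ′} → ρ ≗ ρ′ → ∀ e → renE ρ e ≡ renE ρ′ e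
  renE-cong h (t ⨾ p)    = cong₂ _⨾_ (renT-cong h t) (renP-cong h p)
  renE-cong h (appQ q t) = cong₂ appQ (renQ-cong h q) (renT-cong h t)

extR-∘ : ∀ (ρ ρ′ : ℕ → ℕ) → extR ρ ∘ extR ρ′ ≗ extR (ρ ∘ ρ′)
extR-∘ ρ ρ′ zero    = refl
extR-∘ ρ ρ′ (suc i) = refl

mutual
  renP-∘ : ∀ ρ ρ′ p → renP ρ (renP ρ′ p) ≡ renP (ρ ∘ ρ′) p
  renP-∘ ρ ρ′ (pv i)    = refl
  renP-∘ ρ ρ′ (lamXK u) = cong lamXK (trans (renE-∘ _ _ u) (renE-cong (extR-∘ ρ ρ′) u))
  renP-∘ ρ ρ′ (lamK u)  = cong lamK (renE-∘ ρ ρ′ u)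

  renT-∘ : ∀ ρ ρ′ t → renT ρ (renT ρ′ t) ≡ renT (ρ ∘ ρ′) t
  renT-∘ ρ ρ′ star      = refl
  renT-∘ ρ ρ′ kv        = refl
  renT-∘ ρ ρ′ ⟨ p , t ⟩ = cong₂ ⟨_,_⟩ (renP-∘ ρ ρ′ p) (renT-∘ ρ ρ′ t)
  renT-∘ ρ ρ′ (lamX u)  = cong lamX (trans (renE-∘ _ _ u) (renE-cong (extR-∘ ρ ρ′) u))

  renQ-∘ : ∀ ρ ρ′ q → renQ ρ (renQ ρ′ q) ≡ renQ (ρ ∘ ρ′) q
  renQ-∘ ρ ρ′ (lamBarK u) = cong lamBarK (renE-∘ ρ ρ′ u)

  renE-∘ : ∀ ρ ρ′ e → renE ρ (renE ρ′ e) ≡ renE (ρ ∘ ρ′) e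
  renE-∘ ρ ρ′ (t ⨾ p)    = cong₂ _⨾_ (renT-∘ ρ ρ′ t) (renP-∘ ρ ρ′ p)
  renE-∘ ρ ρ′ (appQ q t) = cong₂ appQ (renQ-∘ ρ ρ′ q) (renT-∘ ρ ρ′ t)

extsP-cong : ∀ {σ σ′ : ℕ → PTerm} → σ ≗ σ′ → extsP σ ≗ extsP σ′
extsP-cong h zero    = refl
extsP-cong h (suc i) = cong (renP suc) (h i)

mutual
  subP-cong : ∀ {σ σ′} → σ ≗ σ′ → ∀ p → subP σ p ≡ subP σ′ p
  subP-cong h (pv i)    = h i
  subP-cong h (lamXK u) = cong lamXK (subE-cong (extsP-cong h) u)
  subP-cong h (lamK u)  = cong lamK (subE-cong h u)

  subT-cong : ∀ {σ σ′} → σ ≗ σ′ → ∀ t → subT σ t ≡ subT σ′ t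
  subT-cong h star      = refl
  subT-cong h kv        = refl
  subT-cong h ⟨ p , t ⟩ = cong₂ ⟨_,_⟩ (subP-cong h p) (subT-cong h t)
  subT-cong h (lamX u)  = cong lamX (subE-cong (extsP-cong h) u)

  subQ-cong : ∀ {σ σ′} → σ ≗ σ′ → ∀ q → subQ σ q ≡ subQ σ′ q
  subQ-cong h (lamBarK u) = cong lamBarK (subE-cong h u)

  subE-cong : ∀ {σ σ′} → σ ≗ σ′ → ∀ e → subE σ e ≡ subE σ′ e
  subE-cong h (t ⨾ p)    = cong₂ _⨾_ (subT-cong h t) (subP-cong h p)
  subE-cong h (appQ q t) = cong₂ appQ (subQ-cong h q) (subT-cong h t)

extsP-extR : ∀ (σ : ℕ → PTerm) (ρ : ℕ → ℕ) → extsP σ ∘ extR ρ ≗ extsP (σ ∘ ρ)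
extsP-extR σ ρ zero    = refl
extsP-extR σ ρ (suc i) = refl

mutual
  subP-renP : ∀ σ ρ p → subP σ (renP ρ p) ≡ subP (σ ∘ ρ) p
  subP-renP σ ρ (pv i)    = refl
  subP-renP σ ρ (lamXK u) = cong lamXK (trans (subE-renE _ _ u) (subE-cong (extsP-extR σ ρ) u))
  subP-renP σ ρ (lamK u)  = cong lamK (subE-renE σ ρ u)

  subT-renT : ∀ σ ρ t → subT σ (renT ρ t) ≡ subT (σ ∘ ρ) t
  subT-renT σ ρ star      = refl
  subT-renT σ ρ kv        = refl
  subT-renT σ ρ ⟨ p , t ⟩ = cong₂ ⟨_,_⟩ (subP-renP σ ρ p) (subT-renT σ ρ t)
  subT-renT σ ρ (lamX u)  = cong lamX (trans (subE-renE _ _ u) (subE-cong (extsP-extR σ ρ) u))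

  subQ-renQ : ∀ σ ρ q → subQ σ (renQ ρ q) ≡ subQ (σ ∘ ρ) q
  subQ-renQ σ ρ (lamBarK u) = cong lamBarK (subE-renE σ ρ u)

  subE-renE : ∀ σ ρ e → subE σ (renE ρ e) ≡ subE (σ ∘ ρ) e
  subE-renE σ ρ (t ⨾ p)    = cong₂ _⨾_ (subT-renT σ ρ t) (subP-renP σ ρ p)
  subE-renE σ ρ (appQ q t) = cong₂ appQ (subQ-renQ σ ρ q) (subT-renT σ ρ t)

extR-extsP : ∀ (ρ : ℕ → ℕ) (σ : ℕ → PTerm) →
             renP (extR ρ) ∘ extsP σ ≗ extsP (renP ρ ∘ σ)
extR-extsP ρ σ zero    = refl
extR-extsP ρ σ (suc i) = trans (renP-∘ (extR ρ) suc (σ i)) (sym (renP-∘ suc ρ (σ i)))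

mutual
  renP-subP : ∀ ρ σ p → renP ρ (subP σ p) ≡ subP (renP ρ ∘ σ) p
  renP-subP ρ σ (pv i)    = refl
  renP-subP ρ σ (lamXK u) = cong lamXK (trans (renE-subE _ _ u) (subE-cong (extR-extsP ρ σ) u))
  renP-subP ρ σ (lamK u)  = cong lamK (renE-subE ρ σ u)

  renT-subT : ∀ ρ σ t → renT ρ (subT σ t) ≡ subT (renP ρ ∘ σ) t
  renT-subT ρ σ star      = refl
  renT-subT ρ σ kv        = refl
  renT-subT ρ σ ⟨ p , t ⟩ = cong₂ ⟨_,_⟩ (renP-subP ρ σ p) (renT-subT ρ σ t)
  renT-subT ρ σ (lamX u)  = cong lamX (trans (renE-subE _ _ u) (subE-cong (extR-extsP ρ σ) u))

  renQ-subQ : ∀ ρ σ q → renQ ρ (subQ σ q) ≡ subQ (renP ρ ∘ σ) q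
  renQ-subQ ρ σ (lamBarK u) = cong lamBarK (renE-subE ρ σ u)

  renE-subE : ∀ ρ σ e → renE ρ (subE σ e) ≡ subE (renP ρ ∘ σ) e
  renE-subE ρ σ (t ⨾ p)    = cong₂ _⨾_ (renT-subT ρ σ t) (renP-subP ρ σ p)
  renE-subE ρ σ (appQ q t) = cong₂ appQ (renQ-subQ ρ σ q) (renT-subT ρ σ t)

extsP-pv : extsP pv ≗ pv
extsP-pv zero    = refl
extsP-pv (suc i) = refl

mutual
  subP-pv : ∀ p → subP pv p ≡ p
  subP-pv (pv i)    = refl
  subP-pv (lamXK u) = cong lamXK (trans (subE-cong extsP-pv u) (subE-pv u))
  subP-pv (lamK u)  = cong lamK (subE-pv u)

  subT-pv : ∀ t → subT pv t ≡ t
  subT-pv star      = refl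
  subT-pv kv        = refl
  subT-pv ⟨ p , t ⟩ = cong₂ ⟨_,_⟩ (subP-pv p) (subT-pv t)
  subT-pv (lamX u)  = cong lamX (trans (subE-cong extsP-pv u) (subE-pv u))

  subQ-pv : ∀ q → subQ pv q ≡ q
  subQ-pv (lamBarK u) = cong lamBarK (subE-pv u)

  subE-pv : ∀ e → subE pv e ≡ e
  subE-pv (t ⨾ p)    = cong₂ _⨾_ (subT-pv t) (subP-pv p)
  subE-pv (appQ q t) = cong₂ appQ (subQ-pv q) (subT-pv t)

subQ-single-weaken : ∀ p q → subQ (singleP' p) (renQ suc q) ≡ q
subQ-single-weaken p q = trans (subQ-renQ (singleP' p) suc q) (subQ-pv q)

subT-single-weaken : ∀ p t → subT (singleP' p) (renT suc t) ≡ t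
subT-single-weaken p t = trans (subT-renT (singleP' p) suc t) (subT-pv t)

mutual
  renP-stP : ∀ ρ p t → renP ρ (stP p t) ≡ stP (renP ρ p) (renT ρ t)
  renP-stP ρ (pv i)    t = refl
  renP-stP ρ (lamXK u) t = cong lamXK (renE-stE-weaken ρ u t)
  renP-stP ρ (lamK u)  t = cong lamK (renE-stE ρ u t)

  renT-stT : ∀ ρ s t → renT ρ (stT s t) ≡ stT (renT ρ s) (renT ρ t)
  renT-stT ρ star      t = refl
  renT-stT ρ kv        t = refl
  renT-stT ρ ⟨ p , s ⟩ t = cong₂ ⟨_,_⟩ (renP-stP ρ p t) (renT-stT ρ s t)
  renT-stT ρ (lamX u)  t = cong lamX (renE-stE-weaken ρ u t)

  renQ-stQ : ∀ ρ q t → renQ ρ (stQ q t) ≡ stQ (renQ ρ q) (renT ρ t)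
  renQ-stQ ρ (lamBarK u) t = cong lamBarK (renE-stE ρ u t)

  renE-stE : ∀ ρ e t → renE ρ (stE e t) ≡ stE (renE ρ e) (renT ρ t)
  renE-stE ρ (s ⨾ p)    t = cong₂ _⨾_ (renT-stT ρ s t) (renP-stP ρ p t)
  renE-stE ρ (appQ q s) t = cong₂ appQ (renQ-stQ ρ q t) (renT-stT ρ s t)

  renE-stE-weaken : ∀ ρ e t → renE (extR ρ) (stE e (renT suc t)) ≡
                              stE (renE (extR ρ) e) (renT suc (renT ρ t))
  renE-stE-weaken ρ e t =
    trans (renE-stE (extR ρ) e (renT suc t))
          (cong (stE (renE (extR ρ) e)) (trans (renT-∘ (extR ρ) suc t) (sym (renT-∘ suc ρ t))))

-- Closedness and k-substitution

closedP-true : ∀ p → closedP p ≡ true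
closedP-true (pv i)    = refl
closedP-true (lamXK u) = refl
closedP-true (lamK u)  = refl

closedQ-true : ∀ q → closedQ q ≡ true
closedQ-true (lamBarK u) = refl

closedT-pair : ∀ p t → closedT t ≡ true → closedT ⟨ p , t ⟩ ≡ true
closedT-pair p t h rewrite closedP-true p = h

closedE-⨾ : ∀ t p → closedT t ≡ true → closedE (t ⨾ p) ≡ true
closedE-⨾ t p h rewrite closedP-true p = trans (∧-identityʳ (closedT t)) h

mutual
  closedT-renT : ∀ ρ t → closedT (renT ρ t) ≡ closedT t
  closedT-renT ρ star      = refl
  closedT-renT ρ kv        = refl
  closedT-renT ρ ⟨ p , t ⟩ =
    cong₂ _∧_ (trans (closedP-true (renP ρ p)) (sym (closedP-true p))) (closedT-renT ρ t)
  closedT-renT ρ (lamX u)  = closedE-renE _ u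

  closedE-renE : ∀ ρ e → closedE (renE ρ e) ≡ closedE e
  closedE-renE ρ (t ⨾ p)    =
    cong₂ _∧_ (closedT-renT ρ t) (trans (closedP-true (renP ρ p)) (sym (closedP-true p)))
  closedE-renE ρ (appQ q t) =
    cong₂ _∧_ (trans (closedQ-true (renQ ρ q)) (sym (closedQ-true q))) (closedT-renT ρ t)

kSubP-id : ∀ p t → kSubP p t ≡ p
kSubP-id (pv i)    t = refl
kSubP-id (lamXK u) t = refl
kSubP-id (lamK u)  t = refl

kSubQ-id : ∀ q t → kSubQ q t ≡ q
kSubQ-id (lamBarK u) t = refl

infixl 3 _▹_ _▹*_

_▹_ : ∀ {a b c} → a ⟶ b → b ≡ c → a ⟶ c
r ▹ refl = r

_▹*_ : ∀ {a b c} → Star _⟶_ a b → b ≡ c → Star _⟶_ a c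
rs ▹* refl = rs

-- Call-by-name

transN-renΛ : ∀ ρ M → transN (renΛ ρ M) ≡ renP ρ (transN M)
transN-renΛ ρ (var i)   = refl
transN-renΛ ρ (lam M)   = cong (λ m → lamXK (kv ⨾ m)) (transN-renΛ (extR ρ) M)
transN-renΛ ρ (app M N) =
  cong₂ (λ n m → lamK (⟨ n , kv ⟩ ⨾ m)) (transN-renΛ ρ N) (transN-renΛ ρ M)

transN-subΛ : ∀ σ M → transN (subΛ σ M) ≡ subP (transN ∘ σ) (transN M)
transN-subΛ σ (var i)   = refl
transN-subΛ σ (lam M)   =
  cong (λ m → lamXK (kv ⨾ m))
       (trans (transN-subΛ (extsΛ σ) M) (subP-cong transN-extsΛ (transN M)))
  where
  transN-extsΛ : transN ∘ extsΛ σ ≗ extsP (transN ∘ σ)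
  transN-extsΛ zero    = refl
  transN-extsΛ (suc i) = transN-renΛ suc (σ i)
transN-subΛ σ (app M N) =
  cong₂ (λ n m → lamK (⟨ n , kv ⟩ ⨾ m)) (transN-subΛ σ N) (transN-subΛ σ M)

transN-single : ∀ B N → transN (B [ N ]) ≡ subP (singleP' (transN N)) (transN B)
transN-single B N = trans (transN-subΛ (single N) B) (subP-cong transN-single′ (transN B))
  where
  transN-single′ : transN ∘ single N ≗ singleP' (transN N)
  transN-single′ zero    = refl
  transN-single′ (suc i) = refl

stP-transN : ∀ M t → stP (transN M) t ≡ transN M
stP-transN (var i)   t = refl
stP-transN (lam M)   t = cong (λ m → lamXK (kv ⨾ m)) (stP-transN M (renT suc t))
stP-transN (app M N) t =
  cong₂ (λ n m → lamK (⟨ n , kv ⟩ ⨾ m)) (stP-transN N t) (stP-transN M t)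

stateN : TTerm → Λ → ETerm
stateN t (var i)   = t ⨾ transN (var i)
stateN t (lam M)   = t ⨾ transN (lam M)
stateN t (app M N) = stateN ⟨ transN N , t ⟩ M

stE-stateN : ∀ M s t → stE (stateN s M) t ≡ stateN (stT s t) M
stE-stateN (var i)   s t = refl
stE-stateN (lam M)   s t = cong (stT s t ⨾_) (stP-transN (lam M) t)
stE-stateN (app M N) s t =
  trans (stE-stateN M ⟨ transN N , s ⟩ t) (cong (λ n → stateN ⟨ n , stT s t ⟩ M) (stP-transN N t))

hatN≡stateN : ∀ M → hatN M ≡ stateN star M
hatN≡stateN (var i)   = refl
hatN≡stateN (lam M)   = refl
hatN≡stateN (app M N) =
  trans (cong (⟨ transN N , star ⟩ ∙_) (hatN≡stateN M)) (stE-stateN M star ⟨ transN N , star ⟩)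

data Stack : TTerm → Set where
  [] : Stack star
  _∷_ : ∀ p {t} → Stack t → Stack ⟨ p , t ⟩

Stack-closed : ∀ {t} → Stack t → closedT t ≡ true
Stack-closed []            = refl
Stack-closed (_∷_ p {t} s) = closedT-pair p t (Stack-closed s)

⨾lamK⟶ : ∀ {t u} → Stack t → (t ⨾ lamK u) ⟶ u [ t /k]
⨾lamK⟶ []                  = r-*k refl
⨾lamK⟶ {u = u} (_∷_ p {t} s) = r-⟨⟩k (closedE-⨾ ⟨ p , t ⟩ (lamK u) (Stack-closed (p ∷ s)))

⨾transN⟶*stateN : ∀ {t} → Stack t → ∀ M → Star _⟶_ (t ⨾ transN M) (stateN t M)
⨾transN⟶*stateN s (var i)       = ε
⨾transN⟶*stateN s (lam M)       = ε
⨾transN⟶*stateN {t} s (app M N) =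
  (⨾lamK⟶ s ▹ cong₂ (λ n m → ⟨ n , t ⟩ ⨾ m) (kSubP-id (transN N) t) (kSubP-id (transN M) t))
  ◅ ⨾transN⟶*stateN (transN N ∷ s) M

stateN-simulates-→n : ∀ {M M′ t} → Stack t → M →n M′ → Star _⟶_ (stateN t M) (stateN t M′)
stateN-simulates-→n {t = t} s (βn {B} {N}) =
  (r-⟨⟩xk (closedE-⨾ ⟨ transN N , t ⟩ (transN (lam B)) (Stack-closed (transN N ∷ s)))
    ▹ cong (t ⨾_) (trans (kSubP-id (subP (singleP' (transN N)) (transN B)) t)
                         (sym (transN-single B N))))
  ◅ ⨾transN⟶*stateN s (B [ N ])
stateN-simulates-→n s (appL {N = N} r) = stateN-simulates-→n (transN N ∷ s) r

cbn-simulation : ∀ M N → Star _→n_ M N → Star _⟶_ (star ⨾ transN M) (hatN N)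
cbn-simulation M N rs =
  ⨾transN⟶*stateN [] M ◅◅ kleisliStar (stateN star) (stateN-simulates-→n []) rs
  ▹* sym (hatN≡stateN N)

-- Call-by-value

renΛ-Value : ∀ ρ {V} → Value V → Value (renΛ ρ V)
renΛ-Value ρ v-var = v-var
renΛ-Value ρ v-lam = v-lam

transV-renΛ : ∀ ρ M → transV (renΛ ρ M) ≡ renQ ρ (transV M)
transV-renΛ ρ (var i)   = refl
transV-renΛ ρ (lam M)   = cong (λ m → lamBarK (kv ⨾ lamXK (appQ m kv))) (transV-renΛ (extR ρ) M)
transV-renΛ ρ (app M N) =
  cong₂ (λ n m → lamBarK (appQ n (lamX (appQ m ⟨ pv zero , kv ⟩))))
    (transV-renΛ ρ N)
    (trans (cong (renQ suc) (transV-renΛ ρ M))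
           (trans (renQ-∘ suc ρ (transV M)) (sym (renQ-∘ (extR ρ) suc (transV M)))))

valV-renΛ : ∀ ρ {V} (v : Value V) → valV (renΛ ρ V) (renΛ-Value ρ v) ≡ renP ρ (valV V v)
valV-renΛ ρ v-var           = refl
valV-renΛ ρ (v-lam {M = M}) = cong (λ m → lamXK (appQ m kv)) (transV-renΛ (extR ρ) M)

transV-Value : ∀ {V} (v : Value V) → transV V ≡ lamBarK (kv ⨾ valV V v)
transV-Value v-var = refl
transV-Value v-lam = refl

transV-subΛ : ∀ σ (vs : ∀ i → Value (σ i)) M →
              transV (subΛ σ M) ≡ subQ (λ i → valV (σ i) (vs i)) (transV M)
transV-subΛ σ vs (var i)   = transV-Value (vs i)
transV-subΛ σ vs (lam M)   =
  cong (λ m → lamBarK (kv ⨾ lamXK (appQ m kv)))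
       (trans (transV-subΛ (extsΛ σ) extsΛ-Value M) (subQ-cong valV-extsΛ (transV M)))
  where
  extsΛ-Value : ∀ i → Value (extsΛ σ i)
  extsΛ-Value zero    = v-var
  extsΛ-Value (suc i) = renΛ-Value suc (vs i)

  valV-extsΛ : (λ i → valV (extsΛ σ i) (extsΛ-Value i)) ≗ extsP (λ i → valV (σ i) (vs i))
  valV-extsΛ zero    = refl
  valV-extsΛ (suc i) = valV-renΛ suc (vs i)
transV-subΛ σ vs (app M N) =
  cong₂ (λ n m → lamBarK (appQ n (lamX (appQ m ⟨ pv zero , kv ⟩))))
    (transV-subΛ σ vs N)
    (trans (cong (renQ suc) (transV-subΛ σ vs M))
           (trans (renQ-subQ suc τ (transV M)) (sym (subQ-renQ (extsP τ) suc (transV M)))))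
  where
  τ : ℕ → PTerm
  τ i = valV (σ i) (vs i)

transV-single : ∀ B {V} (v : Value V) →
                transV (B [ V ]) ≡ subQ (singleP' (valV V v)) (transV B)
transV-single B {V} v =
  trans (transV-subΛ (single V) single-Value B) (subQ-cong valV-single (transV B))
  where
  single-Value : ∀ i → Value (single V i)
  single-Value zero    = v
  single-Value (suc i) = v-var

  valV-single : (λ i → valV (single V i) (single-Value i)) ≗ singleP' (valV V v)
  valV-single zero    = refl
  valV-single (suc i) = refl

mutual
  stQ-transV : ∀ M t → stQ (transV M) t ≡ transV M
  stQ-transV (var i)   t = refl
  stQ-transV (lam M)   t = cong (λ m → lamBarK (kv ⨾ lamXK (appQ m kv))) (stQ-transV M (renT suc t))
  stQ-transV (app M N) t =
    cong₂ (λ n m → lamBarK (appQ n (lamX (appQ m ⟨ pv zero , kv ⟩))))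
      (stQ-transV N t)
      (stQ-renQ-transV M t)

  stQ-renQ-transV : ∀ M t → stQ (renQ suc (transV M)) (renT suc t) ≡ renQ suc (transV M)
  stQ-renQ-transV M t = trans (sym (renQ-stQ suc (transV M) t)) (cong (renQ suc) (stQ-transV M t))

stP-valV : ∀ {V} (v : Value V) t → stP (valV V v) t ≡ valV V v
stP-valV v-var           t = refl
stP-valV (v-lam {M = M}) t = cong (λ m → lamXK (appQ m kv)) (stQ-transV M (renT suc t))

-- The frame λx.M^v⟨x,t⟩ awaiting the value of the argument of M.
argFrame : Λ → TTerm → TTerm
argFrame M t = lamX (appQ (renQ suc (transV M)) ⟨ pv zero , renT suc t ⟩)

stateV : TTerm → Λ → ETerm
stateV t (var i)           = t ⨾ valV (var i) v-var
stateV t (lam M)           = t ⨾ valV (lam M) v-lam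
stateV t (app M (var i))   = stateV ⟨ valV (var i) v-var , t ⟩ M
stateV t (app M (lam N))   = stateV ⟨ valV (lam N) v-lam , t ⟩ M
stateV t (app M (app N L)) = stateV (argFrame M t) (app N L)

stT-argFrame : ∀ M s t → stT (argFrame M s) t ≡ argFrame M (stT s t)
stT-argFrame M s t =
  cong₂ (λ m r → lamX (appQ m ⟨ pv zero , r ⟩)) (stQ-renQ-transV M t) (sym (renT-stT suc s t))

stE-stateV : ∀ M s t → stE (stateV s M) t ≡ stateV (stT s t) M
stE-stateV (var i)           s t = refl
stE-stateV (lam M)           s t = cong (stT s t ⨾_) (stP-valV v-lam t)
stE-stateV (app M (var i))   s t = stE-stateV M ⟨ pv i , s ⟩ t
stE-stateV (app M (lam N))   s t =
  trans (stE-stateV M ⟨ valV (lam N) v-lam , s ⟩ t)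
        (cong (λ n → stateV ⟨ n , stT s t ⟩ M) (stP-valV v-lam t))
stE-stateV (app M (app N L)) s t =
  trans (stE-stateV (app N L) (argFrame M s) t)
        (cong (λ r → stateV r (app N L)) (stT-argFrame M s t))

hatV≡stateV : ∀ M → hatV M ≡ stateV star M
hatV≡stateV (var i)           = refl
hatV≡stateV (lam M)           = refl
hatV≡stateV (app M (var i))   =
  trans (cong (⟨ pv i , star ⟩ ∙_) (hatV≡stateV M)) (stE-stateV M star _)
hatV≡stateV (app M (lam N))   =
  trans (cong (⟨ valV (lam N) v-lam , star ⟩ ∙_) (hatV≡stateV M)) (stE-stateV M star _)
hatV≡stateV (app M (app N L)) =
  trans (cong (argFrame M star ∙_) (hatV≡stateV (app N L))) (stE-stateV (app N L) star _)

closedT-argFrame : ∀ M t → closedT t ≡ true → closedT (argFrame M t) ≡ true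
closedT-argFrame M t h rewrite closedQ-true (renQ suc (transV M)) | closedT-renT suc t = h

argFrame⟶ : ∀ M p t → closedT t ≡ true → (argFrame M t ⨾ p) ⟶ appQ (transV M) ⟨ p , t ⟩
argFrame⟶ M p t h =
  r-x (closedE-⨾ (argFrame M t) p (closedT-argFrame M t h))
  ▹ cong₂ (λ m r → appQ m ⟨ p , r ⟩) (subQ-single-weaken p (transV M)) (subT-single-weaken p t)

transV-app⟶ : ∀ M N t → closedT t ≡ true → appQ (transV (app M N)) t ⟶ appQ (transV N) (argFrame M t)
transV-app⟶ M N t h =
  r-q h ▹ cong₂ (λ n m → appQ n (lamX (appQ m ⟨ pv zero , renT suc t ⟩)))
                (kSubQ-id (transV N) t) (kSubQ-id (renQ suc (transV M)) (renT suc t))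

mutual
  transV⟶*stateV : ∀ t → closedT t ≡ true → ∀ M → Star _⟶_ (appQ (transV M) t) (stateV t M)
  transV⟶*stateV t h (var i)   = r-q h ◅ ε
  transV⟶*stateV t h (lam M)   = r-q h ◅ ε
  transV⟶*stateV t h (app M N) =
    transV-app⟶ M N t h ◅ transV⟶*stateV (argFrame M t) (closedT-argFrame M t h) N
    ◅◅ argFrame⟶*stateV-app t h M N

  argFrame⟶*stateV-app : ∀ t → closedT t ≡ true → ∀ M N →
                          Star _⟶_ (stateV (argFrame M t) N) (stateV t (app M N))
  argFrame⟶*stateV-app t h M (var i)   =
    argFrame⟶ M (pv i) t h ◅ transV⟶*stateV ⟨ pv i , t ⟩ (closedT-pair (pv i) t h) M
  argFrame⟶*stateV-app t h M (lam N)   =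
    argFrame⟶ M p t h ◅ transV⟶*stateV ⟨ p , t ⟩ (closedT-pair p t h) M
    where p = valV (lam N) v-lam
  argFrame⟶*stateV-app t h M (app N L) = ε

βv-simulation : ∀ B {V} (v : Value V) t → closedT t ≡ true →
                Star _⟶_ (⟨ valV V v , t ⟩ ⨾ valV (lam B) v-lam) (stateV t (B [ V ]))
βv-simulation B {V} v t h =
  (r-⟨⟩xk (closedE-⨾ ⟨ valV V v , t ⟩ (valV (lam B) v-lam) (closedT-pair (valV V v) t h))
    ▹ cong (λ b → appQ b t) (trans (kSubQ-id (subQ (singleP' (valV V v)) (transV B)) t)
                                  (sym (transV-single B v))))
  ◅ transV⟶*stateV t h (B [ V ])

stateV-simulates-→v : ∀ {M M′} t → closedT t ≡ true → M →v M′ →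
                      Star _⟶_ (stateV t M) (stateV t M′)
stateV-simulates-→v t h (βv {B} v-var)   = βv-simulation B v-var t h
stateV-simulates-→v t h (βv {B} v-lam)   = βv-simulation B v-lam t h
stateV-simulates-→v t h (appRv {M} {app N L} {N′} r) =
  stateV-simulates-→v (argFrame M t) (closedT-argFrame M t h) r ◅◅ argFrame⟶*stateV-app t h M N′
stateV-simulates-→v t h (appLv {V = var i} _ r) =
  stateV-simulates-→v ⟨ pv i , t ⟩ (closedT-pair (pv i) t h) r
stateV-simulates-→v t h (appLv {V = lam N} _ r) =
  stateV-simulates-→v ⟨ p , t ⟩ (closedT-pair p t h) r
  where p = valV (lam N) v-lam

cbv-simulation : ∀ M N → Star _→v_ M N → Star _⟶_ (appQ (transV M) star) (hatV N)
cbv-simulation M N rs =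
  transV⟶*stateV star refl M ◅◅ kleisliStar (stateV star) (stateV-simulates-→v star refl) rs
  ▹* sym (hatV≡stateV N)

theorem3 : ∀ {Γ A} (M : Λ) → Γ ⊢ M ∶ A →
    (∀ N → Star _→n_ M N → Star _⟶_ (star ⨾ transN M) (hatN N)) ×
    (∀ N → Star _→v_ M N → Star _⟶_ (appQ (transV M) star) (hatV N))
theorem3 M _ = cbn-simulation M , cbv-simulation M
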